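{- Let $f$ be a focus and $s$ a spot. Let $t$ be a term over the signature of $\mathrm{BTA}+\mathrm{REC}$ such that $\mathrm{fix}_x(t)$ is a closed term and such that for every basic action $g.m$ occurring in $t$ either $f\neq g$ or $s\notin N(m)$. Then there exist a variable $y$ and a term $t'$ over the signature of $\mathrm{BTA}+\mathrm{REC}$ such that $\nu^f_s(\mathrm{fix}_x(t))=\mathrm{fix}_y(t')$ is derivable from the axioms of $\mathrm{TC}+\mathrm{REC}$.
   Context: Fix a set $\mathcal F$ of foci, a set $\mathcal M$ of methods and an infinite set $\mathcal S$ of spots. Basic actions are the expressions $f.m$ with $f\in\mathcal F$, $m\in\mathcal M$; there is moreover an internal action $\tau$. A service is a function $H$ from non-empty finite sequences over $\mathcal M$ to $\{\mathsf T,\mathsf F,\mathsf R\}$ such that $H(\alpha)=\mathsf R$ implies $H(\alpha\frown\langle m\rangle)=\mathsf R$; $\partial_m H$ denotes the service $\alpha\mapsto H(\langle m\rangle\frown\alpha)$. A subset $\mathcal M_{md}\subseteq\mathcal M$ of molecular dynamics methods is given, containing for each spot $s$ an undefinedness-test method $\mathrm{undef}(s)$; $N(m)$ is the finite set of spots occurring in $m$, and spots occur only in methods of $\mathcal M_{md}$. A fixed family $\mathrm{MDS}$ of services is given and $H(\langle m\rangle)=\mathsf R$ for all $m\in\mathcal M_{md}$ whenever $H\notin\mathrm{MDS}$. Terms of $\mathrm{TC}$ are built from variables using: constants $\mathsf S$ (termination), $\mathsf D$ (deadlock); for each $a$ which is a basic action or $\tau$, binary postconditional composition $t_1\unlhd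 a\unrhd t_2$; for each $k\ge 0$, cyclic interleaving $\|(\langle t_1\rangle\frown\cdots\frown\langle t_k\rangle)$; deadlock at termination $\mathrm{S2D}(t)$; for each focus $f$ and service $H$, thread-service composition $t/_fH$; for each focus $f$ and spot $s$, restriction $\nu^f_s(t)$. $a\circ t$ abbreviates $t\unlhd a\unrhd t$. $s\in\mathrm{FN}^f(t)$ iff some occurrence of $s$ in a basic action $f.m$ of $t$ is not inside a subterm $\nu^f_s(\cdot)$ (for a sequence of terms, take the union). $t[s'/s]^f$ is capture-avoiding substitution of $s'$ for the free (w.r.t. $f$) occurrences of $s$ in basic actions $f.m$ of $t$. Axioms of $\mathrm{TC}$ ($x,y$ variables, $\alpha$ a sequence of terms, $a$ a basic action, $f,g$ foci, $m$ a method, $s,s'$ spots, $H$ a service, $t$ a term): T1 $x\unlhd\tau\unrhd y=\tau\circ x$; CSI1 $\|(\langle\rangle)=\mathsf S$; CSI2 $\|(\langle\mathsf S\rangle\frown\alpha)=\|(\alpha)$; CSI3 $\|(\langle\mathsf D\rangle\frown\alpha)=\mathrm{S2D}(\|(\alpha))$; CSI4 $\|(\langle\tau\circ x\rangle\frown\alpha)=\tau\circ\|(\alpha\frown\langle x\rangle)$; CSI5 $\|(\langle x\unlhd a\unrhd y\rangle\frown\alpha)=\|(\alpha\frown\langle x\rangle)\unlhd a\unrhd\|(\alpha\frown\langle y\rangle)$; S2D1 $\mathrm{S2D}(\mathsf S)=\mathsf D$; S2D2 $\mathrm{S2D}(\mathsf D)=\mathsf D$; S2D3 $\mathrm{S2D}(\tau\circ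 x)=\tau\circ\mathrm{S2D}(x)$; S2D4 $\mathrm{S2D}(x\unlhd a\unrhd y)=\mathrm{S2D}(x)\unlhd a\unrhd\mathrm{S2D}(y)$; TSC1 $\mathsf S/_fH=\mathsf S$; TSC2 $\mathsf D/_fH=\mathsf D$; TSC3 $(\tau\circ x)/_fH=\tau\circ(x/_fH)$; TSC4 $(x\unlhd g.m\unrhd y)/_fH=(x/_fH)\unlhd g.m\unrhd(y/_fH)$ if $f\ne g$; TSC5 $(x\unlhd f.m\unrhd y)/_fH=\tau\circ(x/_f\partial_mH)$ if $H(\langle m\rangle)=\mathsf T$; TSC6 $(x\unlhd f.m\unrhd y)/_fH=\tau\circ(y/_f\partial_mH)$ if $H(\langle m\rangle)=\mathsf F$; TSC7 $(x\unlhd f.m\unrhd y)/_fH=\mathsf D$ if $H(\langle m\rangle)=\mathsf R$; R1 $\nu^f_s(t)=\nu^f_{s'}(t[s'/s]^f)$ if $s'\notin\mathrm{FN}^f(t)$; R2 $\nu^f_s(\mathsf S)=\mathsf S$; R3 $\nu^f_s(\mathsf D)=\mathsf D$; R4 $\nu^f_s(\tau\circ x)=\tau\circ\nu^f_s(x)$; R5 $\nu^f_s(x\unlhd g.m\unrhd y)=\nu^f_s(x)\unlhd g.m\unrhd\nu^f_s(y)$ if $f\ne g$; R6 $\nu^f_s(x\unlhd f.m\unrhd y)=\nu^f_s(x)\unlhd f.m\unrhd\nu^f_s(y)$ if $s\notin N(m)$; R7 $\|(\langle\nu^f_s(x)\rangle\frown\alpha)=\nu^f_s(\|(\langle x\rangle\frown\alpha))$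 if $s\notin\mathrm{FN}^f(\alpha)$; R8 $\mathrm{S2D}(\nu^f_s(x))=\nu^f_s(\mathrm{S2D}(x))$; R9 $\nu^f_s(x)/_gH=\nu^f_s(x/_gH)$ if $f\ne g$; R10 $\nu^f_s(x)/_fH=x/_fH$ if $H(\langle\mathrm{undef}(s)\rangle)\ne\mathsf F$; R11 $\nu^f_s(\nu^g_{s'}(x))=\nu^g_{s'}(\nu^f_s(x))$. Recursion: $\mathrm{TC}+\mathrm{REC}$ adds for every variable $x$ a variable-binding operator $\mathrm{fix}_x$. A variable $x$ is guarded in $t$ if each free occurrence of $x$ in $t$ lies in a subterm of the form $t'\unlhd a\unrhd t''$. Additional axioms (for any term $t$): REC1 $\mathrm{fix}_x(t)=t[\mathrm{fix}_x(t)/x]$; REC2 $y=t[y/x]\Rightarrow y=\mathrm{fix}_x(t)$ if $x$ is guarded in $t$; REC3 $\mathrm{fix}_x(x)=\mathsf D$. The signature of $\mathrm{BTA}+\mathrm{REC}$ consists only of $\mathsf S$, $\mathsf D$, the postconditional composition operators and the operators $\mathrm{fix}_x$. -}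

module Defs where

open import Data.Nat using (ℕ; suc; _⊔_)
open import Data.Nat.Properties using () renaming (_≟_ to _≟ℕ_)
open import Data.List using (List; []; _∷_; _++_; map; filter; foldr; concatMap)
open import Data.List.NonEmpty using (List⁺; _∷_; _∷⁺_; _⁺∷ʳ_; [_])
open import Data.List.Membership.Propositional using (_∈_; _∉_)
open import Data.List.Relation.Unary.All using (All)
open import Data.List.Relation.Unary.Any using (any?)
open import Data.Product using (Σ; _×_; ∃; ∃-syntax)
open import Data.Bool using (Bool; true; false; if_then_else_)
open import Data.Unit using (⊤)
open import Data.Empty using (⊥)
open import Relation.Nullary using (¬_; Dec; yes; no; does)
open import Relation.Nullary.Decidable using (⌊_⌋)
open import Relation.Binary.PropositionalEquality using (_≡_; _≢_; refl)
open import Relation.Binary using (DecidableEquality)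
open import Function using (_⇔_)

data Reply : Set where
  T F R : Reply

record Setting : Set₁ where
  field
    Focus  : Set
    Method : Set
    Spot   : Set
    _≟F_   : DecidableEquality Focus
    _≟S_   : DecidableEquality Spot
    -- the set S of spots is infinite: every finite list of spots misses a spot
    fresh  : List Spot → Spot
    fresh∉ : ∀ l → fresh l ∉ l
    -- N(m): the finite set of spots occurring in m
    N      : Method → List Spot
    Mmd    : Method → Set
    undef  : Spot → Method
    undef-md  : ∀ s → Mmd (undef s)
    undef-N   : ∀ s → s ∈ N (undef s)
    N-md   : ∀ m s → s ∈ N m → Mmd m
    mren   : (Spot → Spot) → Method → Method
    mren-N : ∀ ρ m s' → (s' ∈ N (mren ρ m)) ⇔ (∃[ s ] (s ∈ N m × ρ s ≡ s'))
    mren-id : ∀ ρ m → All (λ s → ρ s ≡ s) (N m) → mren ρ m ≡ m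
    mren-undef : ∀ ρ s → mren ρ (undef s) ≡ undef (ρ s)
    mren-md : ∀ ρ m → Mmd m → Mmd (mren ρ m)

module Theory (𝒮 : Setting) where
  open Setting 𝒮 public

  record Service : Set where
    field
      ap : List⁺ Method → Reply
      R-closed : ∀ α m → ap α ≡ R → ap (α ⁺∷ʳ m) ≡ R

  open Service public

  reply : Service → Method → Reply
  reply H m = ap H [ m ]

  ∂ : Method → Service → Service
  ap (∂ m H) α = ap H (m ∷⁺ α)
  R-closed (∂ m H) (a ∷ as) m' p = R-closed H (m ∷ a ∷ as) m' p

  module _ (MDS : Service → Set) where
    MDS-condition : Set
    MDS-condition = ∀ H m → ¬ MDS H → Mmd m → reply H m ≡ R

  data Act : Set where
    act : Focus → Method → Act
    tau : Act

  Var : Set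
  Var = ℕ

  data Term : Set where
    var  : Var → Term
    `S   : Term
    `D   : Term
    post : Term → Act → Term → Term          -- t₁ ⊴ a ⊵ t₂
    csi  : List Term → Term                  -- ∥(⟨t₁⟩ ⁀ … ⁀ ⟨tₖ⟩)
    s2d  : Term → Term
    tsc  : Term → Focus → Service → Term     -- t /_f H
    nu   : Focus → Spot → Term → Term
    fix  : Var → Term → Term

  _∘ₐ_ : Act → Term → Term
  a ∘ₐ t = post t a t

  _⁀_ : List Term → List Term → List Term
  _⁀_ = _++_

  ⟨_⟩ : Term → List Term
  ⟨ t ⟩ = t ∷ []

  removeS : Spot → List Spot → List Spot
  removeS s = filter (λ r → ¬? (r ≟S s))
    where
    ¬? : ∀ {P : Set} → Dec P → Dec (¬ P)
    ¬? (yes p) = no (λ q → q p)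
    ¬? (no q) = yes q

  mutual
    FN : Focus → Term → List Spot
    FN f (var x) = []
    FN f `S = []
    FN f `D = []
    FN f (post t₁ (act g m) t₂) with g ≟F f
    ... | yes _ = N m ++ FN f t₁ ++ FN f t₂
    ... | no  _ = FN f t₁ ++ FN f t₂
    FN f (post t₁ tau t₂) = FN f t₁ ++ FN f t₂
    FN f (csi ts) = FNs f ts
    FN f (s2d t) = FN f t
    FN f (tsc t g H) = FN f t
    FN f (nu g s t) with g ≟F f
    ... | yes _ = removeS s (FN f t)
    ... | no  _ = FN f t
    FN f (fix x t) = FN f t

    FNs : Focus → List Term → List Spot
    FNs f [] = []
    FNs f (t ∷ ts) = FN f t ++ FNs f ts

  updS : (Spot → Spot) → Spot → Spot → (Spot → Spot)
  updS ρ r r' v with v ≟S r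
  ... | yes _ = r'
  ... | no  _ = ρ v

  mutual
    ssub : Focus → (Spot → Spot) → Term → Term
    ssub f ρ (var x) = var x
    ssub f ρ `S = `S
    ssub f ρ `D = `D
    ssub f ρ (post t₁ (act g m) t₂) with g ≟F f
    ... | yes _ = post (ssub f ρ t₁) (act g (mren ρ m)) (ssub f ρ t₂)
    ... | no  _ = post (ssub f ρ t₁) (act g m) (ssub f ρ t₂)
    ssub f ρ (post t₁ tau t₂) = post (ssub f ρ t₁) tau (ssub f ρ t₂)
    ssub f ρ (csi ts) = csi (ssubs f ρ ts)
    ssub f ρ (s2d t) = s2d (ssub f ρ t)
    ssub f ρ (tsc t g H) = tsc (ssub f ρ t) g H
    ssub f ρ (nu g r t) with g ≟F f
    ... | no  _ = nu g r (ssub f ρ t)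
    ... | yes _ =
      let vs  = removeS r (FN f t)
          img = map ρ vs
          r'  = if ⌊ any? (λ v → v ≟S r) img ⌋
                  then fresh (r ∷ img ++ FN f t) else r
      in nu g r' (ssub f (updS ρ r r') t)
    ssub f ρ (fix x t) = fix x (ssub f ρ t)

    ssubs : Focus → (Spot → Spot) → List Term → List Term
    ssubs f ρ [] = []
    ssubs f ρ (t ∷ ts) = ssub f ρ t ∷ ssubs f ρ ts

  _[_/_]^_ : Term → Spot → Spot → Focus → Term
  t [ s' / s ]^ f = ssub f (updS (λ v → v) s s') t

  removeV : Var → List Var → List Var
  removeV x = filter (λ y → ¬? (y ≟ℕ x))
    where
    ¬? : ∀ {P : Set} → Dec P → Dec (¬ P)
    ¬? (yes p) = no (λ q → q p)
    ¬? (no q) = yes q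

  mutual
    FV : Term → List Var
    FV (var x) = x ∷ []
    FV `S = []
    FV `D = []
    FV (post t₁ a t₂) = FV t₁ ++ FV t₂
    FV (csi ts) = FVs ts
    FV (s2d t) = FV t
    FV (tsc t g H) = FV t
    FV (nu g s t) = FV t
    FV (fix x t) = removeV x (FV t)

    FVs : List Term → List Var
    FVs [] = []
    FVs (t ∷ ts) = FV t ++ FVs ts

  Closed : Term → Set
  Closed t = FV t ≡ []

  updV : (Var → Term) → Var → Term → (Var → Term)
  updV σ x u y with y ≟ℕ x
  ... | yes _ = u
  ... | no  _ = σ y

  maxL : List ℕ → ℕ
  maxL = foldr _⊔_ 0

  mutual
    sub : (Var → Term) → Term → Term
    sub σ (var x) = σ x
    sub σ `S = `S
    sub σ `D = `D
    sub σ (post t₁ a t₂) = post (sub σ t₁) a (sub σ t₂)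
    sub σ (csi ts) = csi (subs σ ts)
    sub σ (s2d t) = s2d (sub σ t)
    sub σ (tsc t g H) = tsc (sub σ t) g H
    sub σ (nu g s t) = nu g s (sub σ t)
    sub σ (fix x t) =
      let ws  = concatMap (λ w → FV (σ w)) (removeV x (FV t))
          x'  = if ⌊ any? (λ w → w ≟ℕ x) ws ⌋
                  then suc (maxL (ws ++ FV t)) else x
      in fix x' (sub (updV σ x (var x')) t)

    subs : (Var → Term) → List Term → List Term
    subs σ [] = []
    subs σ (t ∷ ts) = sub σ t ∷ subs σ ts

  _[_/ₓ_] : Term → Term → Var → Term
  t [ u /ₓ x ] = sub (updV var x u) t

  mutual
    Guarded : Var → Term → Set
    Guarded x (var y) = y ≢ x
    Guarded x `S = ⊤
    Guarded x `D = ⊤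
    Guarded x (post t₁ a t₂) = ⊤
    Guarded x (csi ts) = Guardeds x ts
    Guarded x (s2d t) = Guarded x t
    Guarded x (tsc t g H) = Guarded x t
    Guarded x (nu g s t) = Guarded x t
    Guarded x (fix y t) with y ≟ℕ x
    ... | yes _ = ⊤
    ... | no  _ = Guarded x t

    Guardeds : Var → List Term → Set
    Guardeds x [] = ⊤
    Guardeds x (t ∷ ts) = Guarded x t × Guardeds x ts

  data IsBTA : Term → Set where
    var  : ∀ x → IsBTA (var x)
    `S   : IsBTA `S
    `D   : IsBTA `D
    post : ∀ {t₁ t₂} a → IsBTA t₁ → IsBTA t₂ → IsBTA (post t₁ a t₂)
    fix  : ∀ x {t} → IsBTA t → IsBTA (fix x t)

  mutual
    Actions : Term → List (Focus × Method)
    Actions (var x) = []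
    Actions `S = []
    Actions `D = []
    Actions (post t₁ (act g m) t₂) = (g Data.Product., m) ∷ Actions t₁ ++ Actions t₂
    Actions (post t₁ tau t₂) = Actions t₁ ++ Actions t₂
    Actions (csi ts) = Actionss ts
    Actions (s2d t) = Actions t
    Actions (tsc t g H) = Actions t
    Actions (nu g s t) = Actions t
    Actions (fix x t) = Actions t

    Actionss : List Term → List (Focus × Method)
    Actionss [] = []
    Actionss (t ∷ ts) = Actions t ++ Actionss ts

  -- derivability from the axioms of TC + REC (equational logic:
  -- equivalence, congruence, axiom instances, conditional axioms;
  -- terms are taken modulo α-conversion of fix-bound variables)

  infix 4 _≈_ _≈s_

  mutual
    data _≈s_ : List Term → List Term → Set where
      []  : [] ≈s []
      _∷_ : ∀ {t u ts us} → t ≈ u → ts ≈s us → (t ∷ ts) ≈s (u ∷ us)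

    data _≈_ : Term → Term → Set where
      refl≈  : ∀ {t} → t ≈ t
      sym≈   : ∀ {t u} → t ≈ u → u ≈ t
      trans≈ : ∀ {t u v} → t ≈ u → u ≈ v → t ≈ v
      post-cong : ∀ {t₁ t₂ u₁ u₂} a → t₁ ≈ u₁ → t₂ ≈ u₂ → post t₁ a t₂ ≈ post u₁ a u₂
      csi-cong  : ∀ {ts us} → ts ≈s us → csi ts ≈ csi us
      s2d-cong  : ∀ {t u} → t ≈ u → s2d t ≈ s2d u
      tsc-cong  : ∀ {t u} f H → t ≈ u → tsc t f H ≈ tsc u f H
      nu-cong   : ∀ {t u} f s → t ≈ u → nu f s t ≈ nu f s u
      fix-cong  : ∀ {t u} x → t ≈ u → fix x t ≈ fix x u
      α-fix     : ∀ x z t → z ∉ FV (fix x t) → fix x t ≈ fix z (t [ var z /ₓ x ])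
      T1   : ∀ x y → post x tau y ≈ tau ∘ₐ x
      CSI1 : csi [] ≈ `S
      CSI2 : ∀ α → csi (⟨ `S ⟩ ⁀ α) ≈ csi α
      CSI3 : ∀ α → csi (⟨ `D ⟩ ⁀ α) ≈ s2d (csi α)
      CSI4 : ∀ x α → csi (⟨ tau ∘ₐ x ⟩ ⁀ α) ≈ tau ∘ₐ csi (α ⁀ ⟨ x ⟩)
      CSI5 : ∀ x y f m α → csi (⟨ post x (act f m) y ⟩ ⁀ α)
                             ≈ post (csi (α ⁀ ⟨ x ⟩)) (act f m) (csi (α ⁀ ⟨ y ⟩))
      S2D1 : s2d `S ≈ `D
      S2D2 : s2d `D ≈ `D
      S2D3 : ∀ x → s2d (tau ∘ₐ x) ≈ tau ∘ₐ s2d x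
      S2D4 : ∀ x y f m → s2d (post x (act f m) y) ≈ post (s2d x) (act f m) (s2d y)
      TSC1 : ∀ f H → tsc `S f H ≈ `S
      TSC2 : ∀ f H → tsc `D f H ≈ `D
      TSC3 : ∀ x f H → tsc (tau ∘ₐ x) f H ≈ tau ∘ₐ tsc x f H
      TSC4 : ∀ x y f g m H → f ≢ g →
               tsc (post x (act g m) y) f H ≈ post (tsc x f H) (act g m) (tsc y f H)
      TSC5 : ∀ x y f m H → reply H m ≡ T →
               tsc (post x (act f m) y) f H ≈ tau ∘ₐ tsc x f (∂ m H)
      TSC6 : ∀ x y f m H → reply H m ≡ F →
               tsc (post x (act f m) y) f H ≈ tau ∘ₐ tsc y f (∂ m H)
      TSC7 : ∀ x y f m H → reply H m ≡ R →
               tsc (post x (act f m) y) f H ≈ `D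
      R1  : ∀ f s s' t → s' ∉ FN f t → nu f s t ≈ nu f s' (t [ s' / s ]^ f)
      R2  : ∀ f s → nu f s `S ≈ `S
      R3  : ∀ f s → nu f s `D ≈ `D
      R4  : ∀ f s x → nu f s (tau ∘ₐ x) ≈ tau ∘ₐ nu f s x
      R5  : ∀ f s x y g m → f ≢ g →
              nu f s (post x (act g m) y) ≈ post (nu f s x) (act g m) (nu f s y)
      R6  : ∀ f s x y m → s ∉ N m →
              nu f s (post x (act f m) y) ≈ post (nu f s x) (act f m) (nu f s y)
      R7  : ∀ f s x α → s ∉ FNs f α →
              csi (⟨ nu f s x ⟩ ⁀ α) ≈ nu f s (csi (⟨ x ⟩ ⁀ α))
      R8  : ∀ f s x → s2d (nu f s x) ≈ nu f s (s2d x)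
      R9  : ∀ f s x g H → f ≢ g → tsc (nu f s x) g H ≈ nu f s (tsc x g H)
      R10 : ∀ f s x H → reply H (undef s) ≢ F → tsc (nu f s x) f H ≈ tsc x f H
      R11 : ∀ f s g s' x → nu f s (nu g s' x) ≈ nu g s' (nu f s x)
      REC1 : ∀ x t → fix x t ≈ t [ fix x t /ₓ x ]
      REC2 : ∀ y x t → Guarded x t → y ≈ t [ y /ₓ x ] → y ≈ fix x t
      REC3 : ∀ x → fix x (var x) ≈ `D

module Submission where

-- Restriction ν^f_s is redundant on a closed BTA + REC term fix_x(t) whose
-- basic actions g.m all satisfy f ≠ g or s ∉ N(m): we derive
-- ν^f_s(fix_x(t)) = fix_x(t), so y = x and t' = t witness Proposition 9.
--
-- Since t may contain free variables and nested fix binders, we prove the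
-- stronger statement ν(tσ) = tτ for all "regular" substitutions σ, τ that
-- close the free variables of t and satisfy τ(w) = ν(σ(w)) on them
-- (nu-commutes).  Postconditional compositions are handled by R5/R6
-- (by T1 and R4 for the internal action); for fix_z(u) either z is unguarded in u, and both
-- sides collapse to D by REC3, or z is guarded, and the unfolding REC1
-- together with the induction hypothesis shows that ν(fix_z(uσ)) solves
-- the guarded equation defining fix_z(uτ), whence REC2 concludes.

open import Defs
open import Data.List.Membership.Propositional using (_∈_; _∉_)
open import Data.Product using (Σ; _×_; _,_; ∃; ∃-syntax)
open import Data.Sum using (_⊎_)
open import Relation.Binary.PropositionalEquality using (_≢_)

open import Data.Nat.Properties using () renaming (_≟_ to _≟ℕ_)
open import Data.List using ([]; _∷_; concatMap)
open import Data.List.Relation.Unary.Any using (here; there; any?)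
open import Data.List.Relation.Unary.Any.Properties using (¬Any[])
open import Data.List.Membership.Propositional using (find)
open import Data.List.Membership.Propositional.Properties
  using (∈-++⁻; ∈-++⁺ˡ; ∈-++⁺ʳ; ∈-filter⁻; ∈-filter⁺; ∈-concatMap⁻)
open import Data.Sum using (inj₁; inj₂)
open import Data.Empty using (⊥-elim)
open import Data.Unit using (⊤; tt)
open import Relation.Nullary using (¬_; Dec; yes; no)
open import Relation.Binary.Bundles using (Setoid)
import Relation.Binary.Reasoning.Setoid as SetoidReasoning
open import Relation.Binary.PropositionalEquality
  using (_≡_; refl; sym; trans; cong; cong₂; subst)

module Substitution (𝒮 : Setting) where
  open Theory 𝒮

  updV-same : ∀ σ z u → updV σ z u z ≡ u
  updV-same σ z u with z ≟ℕ z
  ... | yes _ = refl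
  ... | no z≢z = ⊥-elim (z≢z refl)

  updV-other : ∀ σ z u {w} → w ≢ z → updV σ z u w ≡ σ w
  updV-other σ z u {w} w≢z with w ≟ℕ z
  ... | yes w≡z = ⊥-elim (w≢z w≡z)
  ... | no _ = refl

  ∈-removeV⁻ : ∀ z l {v} → v ∈ removeV z l → v ∈ l × v ≢ z
  ∈-removeV⁻ z l = ∈-filter⁻ _

  ∈-removeV⁺ : ∀ z {l v} → v ∈ l → v ≢ z → v ∈ removeV z l
  ∈-removeV⁺ z = ∈-filter⁺ _

  closed-∉ : ∀ u {v} → Closed u → v ∉ FV u
  closed-∉ u {v} cl v∈u = ¬Any[] (subst (v ∈_) cl v∈u)

  closed-if-no-free : ∀ u → (∀ {v} → v ∉ FV u) → Closed u
  closed-if-no-free u no-free with FV u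
  ... | [] = refl
  ... | v ∷ _ = ⊥-elim (no-free (here refl))

  -- Such a
  -- substitution never forces the renaming of a bound variable (sub-fix),
  -- and this is the invariant kept while descending under binders.
  Regular : (Var → Term) → Set
  Regular σ = ∀ w {v} → v ∈ FV (σ w) → v ≡ w

  var-regular : Regular var
  var-regular w (here v≡w) = v≡w

  regular-upd : ∀ σ z u → Regular σ → (∀ {v} → v ∈ FV u → v ≡ z) →
                Regular (updV σ z u)
  regular-upd σ z u σ-reg u-reg w v∈ with w ≟ℕ z
  ... | yes refl = u-reg v∈
  ... | no _ = σ-reg w v∈

  regular-bind : ∀ σ z → Regular σ → Regular (updV σ z (var z))
  regular-bind σ z σ-reg = regular-upd σ z (var z) σ-reg λ { (here v≡z) → v≡z }

  regular-close : ∀ σ z u → Closed u → Regular σ → Regular (updV σ z u)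
  regular-close σ z u cl σ-reg = regular-upd σ z u σ-reg λ v∈ → ⊥-elim (closed-∉ u cl v∈)

  sub-fix : ∀ σ z t → Regular σ → sub σ (fix z t) ≡ fix z (sub (updV σ z (var z)) t)
  sub-fix σ z t σ-reg
    with any? (λ w → w ≟ℕ z) (concatMap (λ w → FV (σ w)) (removeV z (FV t)))
  ... | no _ = refl
  ... | yes clash with find clash
  ... | z' , z'∈ , z'≡z with find (∈-concatMap⁻ (λ w → FV (σ w)) z'∈)
  ... | w , w∈ , z'∈σw =
    let _ , w≢z = ∈-removeV⁻ z (FV t) w∈ in ⊥-elim (w≢z (trans (sym (σ-reg w z'∈σw)) z'≡z))

  mutual
    sub-ext : ∀ ρ ρ' u → Regular ρ → Regular ρ' →
              (∀ {v} → v ∈ FV u → ρ v ≡ ρ' v) → sub ρ u ≡ sub ρ' u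
    sub-ext ρ ρ' (var x) _ _ agree = agree (here refl)
    sub-ext ρ ρ' `S _ _ _ = refl
    sub-ext ρ ρ' `D _ _ _ = refl
    sub-ext ρ ρ' (post t₁ a t₂) r r' agree =
      cong₂ (λ u₁ u₂ → post u₁ a u₂)
        (sub-ext ρ ρ' t₁ r r' (λ p → agree (∈-++⁺ˡ p)))
        (sub-ext ρ ρ' t₂ r r' (λ p → agree (∈-++⁺ʳ (FV t₁) p)))
    sub-ext ρ ρ' (csi ts) r r' agree = cong csi (subs-ext ρ ρ' ts r r' agree)
    sub-ext ρ ρ' (s2d t) r r' agree = cong s2d (sub-ext ρ ρ' t r r' agree)
    sub-ext ρ ρ' (tsc t f H) r r' agree = cong (λ u → tsc u f H) (sub-ext ρ ρ' t r r' agree)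
    sub-ext ρ ρ' (nu f s t) r r' agree = cong (nu f s) (sub-ext ρ ρ' t r r' agree)
    sub-ext ρ ρ' (fix z t) r r' agree
      rewrite sub-fix ρ z t r | sub-fix ρ' z t r' =
      cong (fix z) (sub-ext _ _ t (regular-bind ρ z r) (regular-bind ρ' z r') agree-bound)
      where
      agree-bound : ∀ {v} → v ∈ FV t → updV ρ z (var z) v ≡ updV ρ' z (var z) v
      agree-bound {v} v∈ with v ≟ℕ z
      ... | yes _ = refl
      ... | no v≢z = agree (∈-removeV⁺ z v∈ v≢z)

    subs-ext : ∀ ρ ρ' us → Regular ρ → Regular ρ' →
               (∀ {v} → v ∈ FVs us → ρ v ≡ ρ' v) → subs ρ us ≡ subs ρ' us
    subs-ext ρ ρ' [] _ _ _ = refl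
    subs-ext ρ ρ' (u ∷ us) r r' agree =
      cong₂ _∷_ (sub-ext ρ ρ' u r r' (λ p → agree (∈-++⁺ˡ p)))
                (subs-ext ρ ρ' us r r' (λ p → agree (∈-++⁺ʳ (FV u) p)))

  mutual
    sub-id : ∀ u → sub var u ≡ u
    sub-id (var x) = refl
    sub-id `S = refl
    sub-id `D = refl
    sub-id (post t₁ a t₂) = cong₂ (λ u₁ u₂ → post u₁ a u₂) (sub-id t₁) (sub-id t₂)
    sub-id (csi ts) = cong csi (subs-id ts)
    sub-id (s2d t) = cong s2d (sub-id t)
    sub-id (tsc t f H) = cong (λ u → tsc u f H) (sub-id t)
    sub-id (nu f s t) = cong (nu f s) (sub-id t)
    sub-id (fix z t) rewrite sub-fix var z t var-regular =
      cong (fix z) (trans (sub-ext _ var t (regular-bind var z var-regular) var-regular bind-is-var)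
                          (sub-id t))
      where
      bind-is-var : ∀ {v} → v ∈ FV t → updV var z (var z) v ≡ var v
      bind-is-var {v} _ with v ≟ℕ z
      ... | yes v≡z = cong var (sym v≡z)
      ... | no _ = refl

    subs-id : ∀ us → subs var us ≡ us
    subs-id [] = refl
    subs-id (u ∷ us) = cong₂ _∷_ (sub-id u) (subs-id us)

  sub-closed : ∀ ρ u → Regular ρ → Closed u → sub ρ u ≡ u
  sub-closed ρ u ρ-reg cl =
    trans (sub-ext ρ var u ρ-reg var-regular (λ v∈ → ⊥-elim (closed-∉ u cl v∈))) (sub-id u)

  FV-sub : ∀ σ t → IsBTA t → Regular σ → ∀ {v} → v ∈ FV (sub σ t) → v ∈ FV t × v ∈ FV (σ v)
  FV-sub σ (var y) _ σ-reg v∈ with σ-reg y v∈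
  ... | refl = here refl , v∈
  FV-sub σ (post t₁ a t₂) (post .a b₁ b₂) σ-reg v∈ with ∈-++⁻ (FV (sub σ t₁)) v∈
  ... | inj₁ v∈₁ = let v∈t₁ , v∈σv = FV-sub σ t₁ b₁ σ-reg v∈₁ in ∈-++⁺ˡ v∈t₁ , v∈σv
  ... | inj₂ v∈₂ = let v∈t₂ , v∈σv = FV-sub σ t₂ b₂ σ-reg v∈₂ in ∈-++⁺ʳ (FV t₁) v∈t₂ , v∈σv
  FV-sub σ (fix z t) (fix .z bt) σ-reg {v} v∈
    with ∈-removeV⁻ z _ (subst (λ u → v ∈ FV u) (sub-fix σ z t σ-reg) v∈)
  ... | v∈body , v≢z =
    let v∈t , v∈σ₁v = FV-sub (updV σ z (var z)) t bt (regular-bind σ z σ-reg) v∈body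
    in ∈-removeV⁺ z v∈t v≢z , subst (λ u → v ∈ FV u) (updV-other σ z (var z) v≢z) v∈σ₁v

  ClosesOn : (Var → Term) → Term → Set
  ClosesOn σ t = ∀ {w} → w ∈ FV t → Closed (σ w)

  sub-closes : ∀ σ t → IsBTA t → Regular σ → ClosesOn σ t → Closed (sub σ t)
  sub-closes σ t bt σ-reg closes = closed-if-no-free (sub σ t) λ v∈ →
    let v∈t , v∈σv = FV-sub σ t bt σ-reg v∈ in closed-∉ (σ _) (closes v∈t) v∈σv

  closes-upd : ∀ σ z t u → ClosesOn σ (fix z t) → Closed u → ClosesOn (updV σ z u) t
  closes-upd σ z t u closes cl {w} w∈ with w ≟ℕ z
  ... | yes _ = cl
  ... | no w≢z = closes (∈-removeV⁺ z w∈ w≢z)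

  sub-comp : ∀ ρ σ τ t → IsBTA t → Regular ρ → Regular σ → Regular τ →
             (∀ {w} → w ∈ FV t → sub ρ (σ w) ≡ τ w) → sub ρ (sub σ t) ≡ sub τ t
  sub-comp ρ σ τ (var x) _ _ _ _ agree = agree (here refl)
  sub-comp ρ σ τ `S _ _ _ _ _ = refl
  sub-comp ρ σ τ `D _ _ _ _ _ = refl
  sub-comp ρ σ τ (post t₁ a t₂) (post .a b₁ b₂) rρ rσ rτ agree =
    cong₂ (λ u₁ u₂ → post u₁ a u₂)
      (sub-comp ρ σ τ t₁ b₁ rρ rσ rτ (λ p → agree (∈-++⁺ˡ p)))
      (sub-comp ρ σ τ t₂ b₂ rρ rσ rτ (λ p → agree (∈-++⁺ʳ (FV t₁) p)))
  sub-comp ρ σ τ (fix z t) (fix .z bt) rρ rσ rτ agree = begin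
    sub ρ (sub σ (fix z t))           ≡⟨ cong (sub ρ) (sub-fix σ z t rσ) ⟩
    sub ρ (fix z (sub σ₁ t))          ≡⟨ sub-fix ρ z (sub σ₁ t) rρ ⟩
    fix z (sub ρ₁ (sub σ₁ t))         ≡⟨ cong (fix z) (sub-comp ρ₁ σ₁ τ₁ t bt
                                           (regular-bind ρ z rρ) (regular-bind σ z rσ)
                                           (regular-bind τ z rτ) agree-bound) ⟩
    fix z (sub τ₁ t)                  ≡⟨ sym (sub-fix τ z t rτ) ⟩
    sub τ (fix z t)                   ∎
    where
    open Relation.Binary.PropositionalEquality.≡-Reasoning
    ρ₁ = updV ρ z (var z)
    σ₁ = updV σ z (var z)
    τ₁ = updV τ z (var z)
    -- ρ₁ coincides with ρ on σ w, because z is not free there when w ≢ z.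
    agree-bound : ∀ {w} → w ∈ FV t → sub ρ₁ (σ₁ w) ≡ τ₁ w
    agree-bound {w} w∈ with w ≟ℕ z
    ... | yes _ = updV-same ρ z (var z)
    ... | no w≢z =
      trans (sub-ext ρ₁ ρ (σ w) (regular-bind ρ z rρ) rρ
               (λ v∈ → updV-other ρ z (var z) λ v≡z → w≢z (trans (sym (rσ w v∈)) v≡z)))
            (agree (∈-removeV⁺ z w∈ w≢z))

  sub-unfold : ∀ σ z t u → IsBTA t → Regular σ → ClosesOn σ (fix z t) → Closed u →
               (sub (updV σ z (var z)) t) [ u /ₓ z ] ≡ sub (updV σ z u) t
  sub-unfold σ z t u bt σ-reg closes cl =
    sub-comp (updV var z u) (updV σ z (var z)) (updV σ z u) t bt
      inst-reg (regular-bind σ z σ-reg) (regular-close σ z u cl σ-reg) agree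
    where
    inst-reg : Regular (updV var z u)
    inst-reg = regular-close var z u cl var-regular
    agree : ∀ {w} → w ∈ FV t → sub (updV var z u) (updV σ z (var z) w) ≡ updV σ z u w
    agree {w} w∈ with w ≟ℕ z
    ... | yes _ = updV-same var z u
    ... | no w≢z = sub-closed (updV var z u) (σ w) inst-reg (closes (∈-removeV⁺ z w∈ w≢z))

module Derivability (𝒮 : Setting) where
  open Theory 𝒮

  ≈-setoid : Setoid _ _
  ≈-setoid = record
    { Carrier = Term
    ; _≈_ = _≈_
    ; isEquivalence = record { refl = refl≈ ; sym = sym≈ ; trans = trans≈ }
    }

  open SetoidReasoning ≈-setoid public

module Guardedness (𝒮 : Setting) where
  open Theory 𝒮
  open Substitution 𝒮
  open Derivability 𝒮

  mutual
    guarded-if-not-free : ∀ z u → z ∉ FV u → Guarded z u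
    guarded-if-not-free z (var y) z∉ y≡z = z∉ (here (sym y≡z))
    guarded-if-not-free z `S _ = tt
    guarded-if-not-free z `D _ = tt
    guarded-if-not-free z (post _ _ _) _ = tt
    guarded-if-not-free z (csi ts) z∉ = guarded-if-not-frees z ts z∉
    guarded-if-not-free z (s2d u) z∉ = guarded-if-not-free z u z∉
    guarded-if-not-free z (tsc u g H) z∉ = guarded-if-not-free z u z∉
    guarded-if-not-free z (nu g s u) z∉ = guarded-if-not-free z u z∉
    guarded-if-not-free z (fix y u) z∉ with y ≟ℕ z
    ... | yes _ = tt
    ... | no y≢z = guarded-if-not-free z u λ z∈ → z∉ (∈-removeV⁺ y z∈ λ z≡y → y≢z (sym z≡y))

    guarded-if-not-frees : ∀ z us → z ∉ FVs us → Guardeds z us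
    guarded-if-not-frees z [] _ = tt
    guarded-if-not-frees z (u ∷ us) z∉ =
      guarded-if-not-free z u (λ z∈ → z∉ (∈-++⁺ˡ z∈)) ,
      guarded-if-not-frees z us (λ z∈ → z∉ (∈-++⁺ʳ (FV u) z∈))

  guarded-fix-intro : ∀ z y u → (y ≢ z → Guarded z u) → Guarded z (fix y u)
  guarded-fix-intro z y u guarded-body with y ≟ℕ z
  ... | yes _ = tt
  ... | no y≢z = guarded-body y≢z

  guarded-fix-elim : ∀ z y u → y ≢ z → Guarded z (fix y u) → Guarded z u
  guarded-fix-elim z y u y≢z guarded with y ≟ℕ z
  ... | yes y≡z = ⊥-elim (y≢z y≡z)
  ... | no _ = guarded

  guarded-sub : ∀ z ρ t → IsBTA t → Regular ρ → (∀ w → w ≢ z → Guarded z (ρ w)) →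
                Guarded z t → Guarded z (sub ρ t)
  guarded-sub z ρ (var y) _ _ ρ-guarded y≢z = ρ-guarded y y≢z
  guarded-sub z ρ `S _ _ _ _ = tt
  guarded-sub z ρ `D _ _ _ _ = tt
  guarded-sub z ρ (post _ _ _) _ _ _ _ = tt
  guarded-sub z ρ (fix y t) (fix .y bt) ρ-reg ρ-guarded t-guarded =
    subst (Guarded z) (sym (sub-fix ρ y t ρ-reg)) (guarded-fix-intro z y _ λ y≢z →
      guarded-sub z (updV ρ y (var y)) t bt (regular-bind ρ y ρ-reg) (bound-guarded y≢z)
        (guarded-fix-elim z y t y≢z t-guarded))
    where
    bound-guarded : y ≢ z → ∀ w → w ≢ z → Guarded z (updV ρ y (var y) w)
    bound-guarded y≢z w w≢z with w ≟ℕ y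
    ... | yes _ = y≢z
    ... | no _ = ρ-guarded w w≢z

  guarded-bind : ∀ σ z t → IsBTA t → Regular σ → Guarded z t →
                 Guarded z (sub (updV σ z (var z)) t)
  guarded-bind σ z t bt σ-reg =
    guarded-sub z (updV σ z (var z)) t bt (regular-bind σ z σ-reg) bound-guarded
    where
    bound-guarded : ∀ w → w ≢ z → Guarded z (updV σ z (var z) w)
    bound-guarded w w≢z =
      subst (Guarded z) (sym (updV-other σ z (var z) w≢z))
        (guarded-if-not-free z (σ w) λ z∈ → w≢z (sym (σ-reg w z∈)))

  guarded? : ∀ z t → IsBTA t → Dec (Guarded z t)
  guarded? z (var y) _ with y ≟ℕ z
  ... | yes y≡z = no λ y≢z → y≢z y≡z
  ... | no y≢z = yes y≢z
  guarded? z `S _ = yes tt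
  guarded? z `D _ = yes tt
  guarded? z (post _ _ _) _ = yes tt
  guarded? z (fix y t) (fix .y bt) with y ≟ℕ z
  ... | yes _ = yes tt
  ... | no _ = guarded? z t bt

  -- A BTA term in which z is unguarded is, derivably, the variable z itself
  -- (possibly under binders fix_y that do not bind it; REC1 removes those).
  unguarded-sub : ∀ z σ t → IsBTA t → Regular σ → σ z ≡ var z → ¬ Guarded z t →
                  sub σ t ≈ var z
  unguarded-sub z σ (var y) _ _ σz≡z unguarded with y ≟ℕ z
  ... | yes refl = subst (_≈ var z) (sym σz≡z) refl≈
  ... | no y≢z = ⊥-elim (unguarded y≢z)
  unguarded-sub z σ `S _ _ _ unguarded = ⊥-elim (unguarded tt)
  unguarded-sub z σ `D _ _ _ unguarded = ⊥-elim (unguarded tt)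
  unguarded-sub z σ (post _ _ _) _ _ _ unguarded = ⊥-elim (unguarded tt)
  unguarded-sub z σ (fix y t) (fix .y bt) σ-reg σz≡z unguarded with y ≟ℕ z
  ... | yes _ = ⊥-elim (unguarded tt)
  ... | no y≢z = begin
    sub σ (fix y t)                   ≡⟨ sub-fix σ y t σ-reg ⟩
    fix y (sub (updV σ y (var y)) t)  ≈⟨ fix-cong y (unguarded-sub z _ t bt (regular-bind σ y σ-reg)
                                           (trans (updV-other σ y (var y) z≢y) σz≡z) unguarded) ⟩
    fix y (var z)                     ≈⟨ REC1 y (var z) ⟩
    var z [ fix y (var z) /ₓ y ]      ≡⟨ updV-other var y (fix y (var z)) z≢y ⟩
    var z                             ∎
    where
    z≢y : z ≢ y
    z≢y z≡y = y≢z (sym z≡y)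

  unguarded-fix : ∀ σ z t → IsBTA t → Regular σ → ¬ Guarded z t → sub σ (fix z t) ≈ `D
  unguarded-fix σ z t bt σ-reg unguarded = begin
    sub σ (fix z t)                   ≡⟨ sub-fix σ z t σ-reg ⟩
    fix z (sub (updV σ z (var z)) t)  ≈⟨ fix-cong z (unguarded-sub z _ t bt (regular-bind σ z σ-reg)
                                           (updV-same σ z (var z)) unguarded) ⟩
    fix z (var z)                     ≈⟨ REC3 z ⟩
    `D                                ∎

module Restriction (𝒮 : Setting) (f : Setting.Focus 𝒮) (s : Setting.Spot 𝒮) where
  open Theory 𝒮
  open Substitution 𝒮
  open Derivability 𝒮
  open Guardedness 𝒮

  Harmless : Act → Set
  Harmless (act g m) = (f ≢ g) ⊎ (s ∉ N m)
  Harmless tau = ⊤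

  HarmlessActions : Term → Set
  HarmlessActions t = ∀ g m → (g , m) ∈ Actions t → Harmless (act g m)

  harmless-post : ∀ t₁ a t₂ → HarmlessActions (post t₁ a t₂) →
                  Harmless a × HarmlessActions t₁ × HarmlessActions t₂
  harmless-post t₁ (act g m) t₂ h =
    h g m (here refl) ,
    (λ g' m' p → h g' m' (there (∈-++⁺ˡ p))) ,
    (λ g' m' p → h g' m' (there (∈-++⁺ʳ (Actions t₁) p)))
  harmless-post t₁ tau t₂ h =
    tt , (λ g' m' p → h g' m' (∈-++⁺ˡ p)) , (λ g' m' p → h g' m' (∈-++⁺ʳ (Actions t₁) p))

  nu-post : ∀ A a B → Harmless a → nu f s (post A a B) ≈ post (nu f s A) a (nu f s B)
  nu-post A tau B _ = begin
    nu f s (post A tau B)         ≈⟨ nu-cong f s (T1 A B) ⟩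
    nu f s (tau ∘ₐ A)             ≈⟨ R4 f s A ⟩
    tau ∘ₐ nu f s A               ≈⟨ T1 (nu f s A) (nu f s B) ⟨
    post (nu f s A) tau (nu f s B) ∎
  nu-post A (act g m) B (inj₁ f≢g) = R5 f s A B g m f≢g
  nu-post A (act g m) B (inj₂ s∉m) with g ≟F f
  ... | yes refl = R6 f s A B m s∉m
  ... | no g≢f = R5 f s A B g m λ f≡g → g≢f (sym f≡g)

  record NuRelated (σ τ : Var → Term) (t : Term) : Set where
    field
      σ-regular : Regular σ
      τ-regular : Regular τ
      σ-closes  : ClosesOn σ t
      τ-closes  : ClosesOn τ t
      τ≈νσ      : ∀ {w} → w ∈ FV t → τ w ≈ nu f s (σ w)

  nu-related-⊆ : ∀ {σ τ t t'} → (∀ {w} → w ∈ FV t' → w ∈ FV t) →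
                 NuRelated σ τ t → NuRelated σ τ t'
  nu-related-⊆ ⊆ rel = record
    { σ-regular = σ-regular ; τ-regular = τ-regular
    ; σ-closes = λ w∈ → σ-closes (⊆ w∈) ; τ-closes = λ w∈ → τ-closes (⊆ w∈)
    ; τ≈νσ = λ w∈ → τ≈νσ (⊆ w∈) }
    where open NuRelated rel

  nu-related-bind : ∀ {σ τ z t} U → Closed U → NuRelated σ τ (fix z t) →
                    NuRelated (updV σ z U) (updV τ z (nu f s U)) t
  nu-related-bind {σ} {τ} {z} {t} U cl rel = record
    { σ-regular = regular-close σ z U cl σ-regular
    ; τ-regular = regular-close τ z (nu f s U) cl τ-regular
    ; σ-closes = closes-upd σ z t U σ-closes cl
    ; τ-closes = closes-upd τ z t (nu f s U) τ-closes cl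
    ; τ≈νσ = related
    }
    where
    open NuRelated rel
    related : ∀ {w} → w ∈ FV t → updV τ z (nu f s U) w ≈ nu f s (updV σ z U w)
    related {w} w∈ with w ≟ℕ z
    ... | yes _ = refl≈
    ... | no w≢z = τ≈νσ (∈-removeV⁺ z w∈ w≢z)

  NuCommutes : Term → Set
  NuCommutes t = ∀ σ τ → NuRelated σ τ t → nu f s (sub σ t) ≈ sub τ t

  nu-commutes-post : ∀ t₁ a t₂ → Harmless a → NuCommutes t₁ → NuCommutes t₂ →
                     NuCommutes (post t₁ a t₂)
  nu-commutes-post t₁ a t₂ harmless ih₁ ih₂ σ τ rel = begin
    nu f s (post (sub σ t₁) a (sub σ t₂))             ≈⟨ nu-post _ a _ harmless ⟩
    post (nu f s (sub σ t₁)) a (nu f s (sub σ t₂))   ≈⟨ post-cong a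
        (ih₁ σ τ (nu-related-⊆ ∈-++⁺ˡ rel)) (ih₂ σ τ (nu-related-⊆ (∈-++⁺ʳ (FV t₁)) rel)) ⟩
    post (sub τ t₁) a (sub τ t₂)                     ∎

  -- The guarded case: ν(fix_z(tσ₁)) satisfies the recursion equation of
  -- fix_z(tτ₁), where σ₁, τ₁ bind z to itself, so REC2 identifies them.
  nu-commutes-guarded : ∀ z t → IsBTA t → Guarded z t → NuCommutes t →
                        NuCommutes (fix z t)
  nu-commutes-guarded z t bt guarded ih σ τ rel = begin
    nu f s (sub σ (fix z t))  ≡⟨ cong (nu f s) (sub-fix σ z t σ-regular) ⟩
    V                         ≈⟨ REC2 V z B (guarded-bind τ z t bt τ-regular guarded) V-solves ⟩
    fix z B                   ≡⟨ sym (sub-fix τ z t τ-regular) ⟩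
    sub τ (fix z t)           ∎
    where
    open NuRelated rel
    A = sub (updV σ z (var z)) t
    B = sub (updV τ z (var z)) t
    U = fix z A
    V = nu f s U
    U-closed : Closed U
    U-closed = subst Closed (sub-fix σ z t σ-regular) (sub-closes σ (fix z t) (fix z bt) σ-regular σ-closes)
    V-solves : V ≈ B [ V /ₓ z ]
    V-solves = begin
      nu f s U                   ≈⟨ nu-cong f s (REC1 z A) ⟩
      nu f s (A [ U /ₓ z ])      ≡⟨ cong (nu f s) (sub-unfold σ z t U bt σ-regular σ-closes U-closed) ⟩
      nu f s (sub (updV σ z U) t) ≈⟨ ih _ _ (nu-related-bind U U-closed rel) ⟩
      sub (updV τ z V) t         ≡⟨ sym (sub-unfold τ z t V bt τ-regular τ-closes U-closed) ⟩
      B [ V /ₓ z ]               ∎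

  nu-commutes-fix : ∀ z t → IsBTA t → NuCommutes t → NuCommutes (fix z t)
  nu-commutes-fix z t bt ih σ τ rel with guarded? z t bt
  ... | yes guarded = nu-commutes-guarded z t bt guarded ih σ τ rel
  ... | no unguarded = begin
    nu f s (sub σ (fix z t))  ≈⟨ nu-cong f s (unguarded-fix σ z t bt σ-regular unguarded) ⟩
    nu f s `D                 ≈⟨ R3 f s ⟩
    `D                        ≈⟨ unguarded-fix τ z t bt τ-regular unguarded ⟨
    sub τ (fix z t)           ∎
    where open NuRelated rel

  nu-commutes : ∀ t → IsBTA t → HarmlessActions t → NuCommutes t
  nu-commutes (var x) _ _ σ τ rel = sym≈ (NuRelated.τ≈νσ rel (here refl))
  nu-commutes `S _ _ _ _ _ = R2 f s
  nu-commutes `D _ _ _ _ _ = R3 f s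
  nu-commutes (post t₁ a t₂) (post .a b₁ b₂) harmless =
    let harmless-a , harmless₁ , harmless₂ = harmless-post t₁ a t₂ harmless
    in nu-commutes-post t₁ a t₂ harmless-a
         (nu-commutes t₁ b₁ harmless₁) (nu-commutes t₂ b₂ harmless₂)
  nu-commutes (fix z t) (fix .z bt) harmless =
    nu-commutes-fix z t bt (nu-commutes t bt harmless)

  nu-redundant : ∀ u → IsBTA u → Closed u → HarmlessActions u → nu f s u ≈ u
  nu-redundant u bu cl harmless =
    subst (λ k → nu f s k ≈ k) (sub-id u) (nu-commutes u bu harmless var var identity-related)
    where
    identity-related : NuRelated var var u
    identity-related = record
      { σ-regular = var-regular ; τ-regular = var-regular
      ; σ-closes = λ w∈ → ⊥-elim (closed-∉ u cl w∈)
      ; τ-closes = λ w∈ → ⊥-elim (closed-∉ u cl w∈)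
      ; τ≈νσ = λ w∈ → ⊥-elim (closed-∉ u cl w∈) }

proposition9 : (𝒮 : Setting) → let open Theory 𝒮 in
    (MDS : Service → Set) → MDS-condition MDS →
    ∀ (f : Focus) (s : Spot) (x : Var) (t : Term) →
    IsBTA t → Closed (fix x t) →
    (∀ g m → (g , m) ∈ Actions t → (f ≢ g) ⊎ (s ∉ N m)) →
    ∃[ y ] ∃[ t' ] (IsBTA t' × (nu f s (fix x t) ≈ fix y t'))
proposition9 𝒮 _ _ f s x t bt closed harmless =
  x , t , bt , nu-redundant (fix x t) (fix x bt) closed harmless
  where
  open Theory 𝒮
  open Restriction 𝒮 f s
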